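{- Let $\mathcal{M}=\langle M,\mathcal{S}^{\mathcal{M}},\in^{\mathcal{M}}\rangle$ be a model of $\mathrm{CAS}$. Then $\mathcal{M}\models\mathrm{BAC}^+$ if and only if $\langle M,\mathcal{S}^{\mathcal{M}},\subseteq^{\mathcal{M}}\rangle\models\mathrm{IABA}_{\mathrm{Ideal}}$ (with $\mathcal{S}^{\mathcal{M}}$ interpreting $\mathcal{I}$).
   Context: $\mathcal{L}_{cl}$ has binary $\in$ and unary $\mathcal{S}$; elements of $\mathcal{S}^{\mathcal{M}}$ are sets, all elements are classes (lowercase variables over sets, uppercase over classes). $\mathrm{CAS}$ has axioms: (Mem) if $X\in Y$ then $X$ is a set; (Subset) if $x$ is a set and every set in $X$ is in $x$ then $X$ is a set; (Emp) there is a set with no set members; (Adj) for sets $x,y$ there is a set $z$ with, for all sets $u$, $u\in z\iff(u\in x\lor u=y)$. $\mathrm{BAC}$ extends $\mathrm{CAS}$ with: (CExt) classes with the same set members are equal; (Union) for sets $x,y$ there is a set whose set members are those in $x$ or $y$; (UB) for every set $x$ there is a set $y\notin x$; (CUnion),(CIntersection) closure of classes under union and intersection; (CComp) every class $X$ has a class whose set members are exactly the sets not in $X$. $\mathrm{BAC}^+$ is $\mathrm{BAC}$ plus (Sep): for every class $X$ that is not a set there is a class $Y\subseteq X$ such that neither $Y$ nor $X\setminus Y$ is a set. $X\subseteq^{\mathcal{M}}Y$ iff every set member of $X$ is a member of $Y$. $\mathrm{IABA}_{\mathrm{Ideal}}$ is the theory in $\{\sqsubseteq,\mathcal{I}\}$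 consisting of: $\sqsubseteq$ is an infinite atomic Boolean algebra (distributive complemented lattice order with $0$, $1$, every nonzero element above an atom, infinitely many atoms; complement $\dotminus$, meet $\dot\land$); $\mathcal{I}$ is a proper ideal (contains $0$, not $1$, closed under binary joins, downward closed); for each $n\in\mathbb{N}$, every element with at most $n$ atoms below it is in $\mathcal{I}$; and $\forall x(\neg\mathcal{I}(x)\Rightarrow\exists y(y\sqsubseteq x\land\neg\mathcal{I}(y)\land\neg\mathcal{I}(x\dot\land\dotminus y)))$. -}

module Defs where

open import Level using (Level; suc)
open import Data.Nat using (ℕ)
open import Data.Fin using (Fin)
open import Data.Product using (Σ; ∃; ∃-syntax; _×_; _,_)
open import Data.Sum using (_⊎_)
open import Relation.Nullary using (¬_)
open import Relation.Binary.PropositionalEquality using (_≡_)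
open import Function.Bundles using (_⇔_)

-- L_cl-structures ⟨M, S, ∈⟩  (carrier M; unary S = "is a set"; binary ∈)

record ClStructure (ℓ : Level) : Set (suc ℓ) where
  field
    M    : Set ℓ
    S    : M → Set ℓ
    _∈ₘ_ : M → M → Set ℓ

module _ {ℓ : Level} (𝓜 : ClStructure ℓ) where
  open ClStructure 𝓜

  _⊆ᴹ_ : M → M → Set ℓ
  X ⊆ᴹ Y = ∀ u → S u → u ∈ₘ X → u ∈ₘ Y

  Mem : Set ℓ
  Mem = ∀ X Y → X ∈ₘ Y → S X

  SubsetAx : Set ℓ
  SubsetAx = ∀ x X → S x → (∀ u → S u → u ∈ₘ X → u ∈ₘ x) → S X

  Emp : Set ℓ
  Emp = ∃[ e ] (S e × (∀ u → S u → ¬ (u ∈ₘ e)))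

  Adj : Set ℓ
  Adj = ∀ x y → S x → S y →
        ∃[ z ] (S z × (∀ u → S u → (u ∈ₘ z ⇔ (u ∈ₘ x ⊎ u ≡ y))))

  CAS : Set ℓ
  CAS = Mem × SubsetAx × Emp × Adj

  CExt : Set ℓ
  CExt = ∀ X Y → (∀ u → S u → (u ∈ₘ X ⇔ u ∈ₘ Y)) → X ≡ Y

  UnionAx : Set ℓ
  UnionAx = ∀ x y → S x → S y →
            ∃[ z ] (S z × (∀ u → S u → (u ∈ₘ z ⇔ (u ∈ₘ x ⊎ u ∈ₘ y))))

  UB : Set ℓ
  UB = ∀ x → S x → ∃[ y ] (S y × ¬ (y ∈ₘ x))

  CUnion : Set ℓ
  CUnion = ∀ X Y → ∃[ Z ] (∀ u → S u → (u ∈ₘ Z ⇔ (u ∈ₘ X ⊎ u ∈ₘ Y)))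

  CIntersection : Set ℓ
  CIntersection = ∀ X Y → ∃[ Z ] (∀ u → S u → (u ∈ₘ Z ⇔ (u ∈ₘ X × u ∈ₘ Y)))

  CComp : Set ℓ
  CComp = ∀ X → ∃[ Z ] (∀ u → S u → (u ∈ₘ Z ⇔ (¬ (u ∈ₘ X))))

  BAC : Set ℓ
  BAC = CAS × CExt × UnionAx × UB × CUnion × CIntersection × CComp

  -- Sep: for every non-set class X there is Y ⊆ X with neither Y nor X∖Y a set.
  -- "X∖Y" is the class D whose set members are the set members of X not in Y.
  Sep : Set ℓ
  Sep = ∀ X → ¬ S X →
        ∃[ Y ] (Y ⊆ᴹ X × ¬ S Y ×
                ∃[ D ] ((∀ u → S u → (u ∈ₘ D ⇔ (u ∈ₘ X × ¬ (u ∈ₘ Y)))) × ¬ S D))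

  BAC⁺ : Set ℓ
  BAC⁺ = BAC × Sep

module _ {ℓ : Level} (A : Set ℓ) (_⊑_ : A → A → Set ℓ) (I : A → Set ℓ) where

  IsBottom : A → Set ℓ
  IsBottom z = ∀ y → z ⊑ y

  IsTop : A → Set ℓ
  IsTop t = ∀ y → y ⊑ t

  IsMeet : A → A → A → Set ℓ
  IsMeet x y m = (m ⊑ x × m ⊑ y) × (∀ w → w ⊑ x → w ⊑ y → w ⊑ m)

  IsJoin : A → A → A → Set ℓ
  IsJoin x y j = (x ⊑ j × y ⊑ j) × (∀ w → x ⊑ w → y ⊑ w → j ⊑ w)

  IsCompl : A → A → Set ℓ
  IsCompl x c = (∀ m → IsMeet x c m → IsBottom m) × (∀ j → IsJoin x c j → IsTop j)

  IsAtom : A → Set ℓ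
  IsAtom a = ¬ IsBottom a × (∀ b → b ⊑ a → IsBottom b ⊎ b ≡ a)

  PartialOrder : Set ℓ
  PartialOrder = (∀ x → x ⊑ x)
               × (∀ x y → x ⊑ y → y ⊑ x → x ≡ y)
               × (∀ x y z → x ⊑ y → y ⊑ z → x ⊑ z)

  Lattice01 : Set ℓ
  Lattice01 = ∃ IsBottom × ∃ IsTop
            × (∀ x y → ∃ (IsMeet x y)) × (∀ x y → ∃ (IsJoin x y))

  -- x ∧ (y ∨ z) = (x ∧ y) ∨ (x ∧ z)
  Distributive : Set ℓ
  Distributive = ∀ x y z j m a b k →
    IsJoin y z j → IsMeet x j m → IsMeet x y a → IsMeet x z b → IsJoin a b k →
    m ≡ k

  Complemented : Set ℓ
  Complemented = ∀ x → ∃ (IsCompl x)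

  Atomic : Set ℓ
  Atomic = ∀ x → ¬ IsBottom x → ∃[ a ] (IsAtom a × a ⊑ x)

  -- infinitely many atoms (first-order scheme: for each n, at least n distinct atoms)
  InfinitelyManyAtoms : Set ℓ
  InfinitelyManyAtoms = (n : ℕ) → Σ (Fin n → A) λ f → ((∀ (i : Fin n) → IsAtom (f i))
                                       × (∀ i j → f i ≡ f j → i ≡ j))

  InfiniteAtomicBA : Set ℓ
  InfiniteAtomicBA = PartialOrder × Lattice01 × Distributive × Complemented
                   × Atomic × InfinitelyManyAtoms

  ProperIdeal : Set ℓ
  ProperIdeal = (∀ z → IsBottom z → I z)
              × (∀ t → IsTop t → ¬ I t)
              × (∀ x y j → IsJoin x y j → I x → I y → I j)
              × (∀ x y → y ⊑ x → I x → I y)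

  AtMostAtomsBelow : ℕ → A → Set ℓ
  AtMostAtomsBelow n x =
    Σ (Fin n → A) λ f → ∀ a → IsAtom a → a ⊑ x → ∃[ i ] (a ≡ f i)

  FiniteInIdeal : Set ℓ
  FiniteInIdeal = (n : ℕ) → ∀ x → AtMostAtomsBelow n x → I x

  Splitting : Set ℓ
  Splitting = ∀ x → ¬ I x →
    ∃[ y ] (y ⊑ x × ¬ I y × (∀ c m → IsCompl y c → IsMeet x c m → ¬ I m))

  IABA-Ideal : Set ℓ
  IABA-Ideal = InfiniteAtomicBA × ProperIdeal × FiniteInIdeal × Splitting

-- Membership of a set u in a class X is visible in the order: u ∈ X iff {u} ⊆ᴹ X, where
-- {u} is Adj(∅, u). Hence meets are intersections and, once extensionality holds, the
-- atoms are the singletons and the sets form an ideal exactly when Subset, Union and UB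
-- hold (a class with finitely many atoms below it is covered by finitely many
-- singletons). In the other direction distributivity, applied to {u} ∧ (X ∨ Y), forces
-- joins to be unions, so the Boolean operations are the class operations of BAC, and
-- the splitting axiom is Sep read through complements.
module Submission where

open import Defs
open import Level using (Level)
open import Function.Bundles using (_⇔_; mk⇔; Equivalence)
open import Axiom.ExcludedMiddle using (ExcludedMiddle)
open ClStructure using (M; S)
open import Axiom.DoubleNegationElimination using (em⇒dne)
open import Data.Nat using (ℕ; zero; suc)
open import Data.Fin using (Fin; zero; suc)
open import Data.Vec.Functional using (_∷_)
open import Data.Product using (∃; ∃-syntax; _×_; _,_; proj₁; proj₂)
open import Data.Product.Function.NonDependent.Propositional using (_×-⇔_)
open import Data.Sum using (_⊎_; inj₁; inj₂; [_,_])
open import Data.Sum.Function.Propositional using (_⊎-⇔_)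
open import Data.Empty using (⊥-elim)
open import Function using (_∘_; id)
open import Function.Construct.Identity using (⇔-id)
open import Function.Construct.Symmetry using (⇔-sym)
open import Function.Construct.Composition using (_⇔-∘_)
open import Function.Related.Propositional using (module EquationalReasoning)
open import Function.Related.TypeIsomorphisms using (×-distribˡ-⊎)
open import Relation.Nullary using (¬_; yes; no)
open import Relation.Binary.PropositionalEquality using (_≡_; refl; sym; subst; cong)

open Equivalence using (to; from)

private
  variable
    ℓ : Level

module ClassAlgebra (𝓜 : ClStructure ℓ) where
  open ClStructure 𝓜 public using (_∈ₘ_)

  Class : Set ℓ
  Class = M 𝓜

  IsSet : Class → Set ℓ
  IsSet = S 𝓜

  infix 4 _⊆_
  _⊆_ : Class → Class → Set ℓ
  _⊆_ = _⊆ᴹ_ 𝓜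

  Meet Join : Class → Class → Class → Set ℓ
  Meet = IsMeet Class _⊆_ IsSet
  Join = IsJoin Class _⊆_ IsSet

  Bottom Top Atom : Class → Set ℓ
  Bottom = IsBottom Class _⊆_ IsSet
  Top = IsTop Class _⊆_ IsSet
  Atom = IsAtom Class _⊆_ IsSet

  Compl : Class → Class → Set ℓ
  Compl = IsCompl Class _⊆_ IsSet

  IsIntersection IsUnion IsDifference : Class → Class → Class → Set ℓ
  IsIntersection X Y Z = ∀ u → IsSet u → (u ∈ₘ Z ⇔ (u ∈ₘ X × u ∈ₘ Y))
  IsUnion X Y Z = ∀ u → IsSet u → (u ∈ₘ Z ⇔ (u ∈ₘ X ⊎ u ∈ₘ Y))
  IsDifference X Y Z = ∀ u → IsSet u → (u ∈ₘ Z ⇔ (u ∈ₘ X × ¬ u ∈ₘ Y))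

  IsComplement : Class → Class → Set ℓ
  IsComplement X Z = ∀ u → IsSet u → (u ∈ₘ Z ⇔ (¬ u ∈ₘ X))

  JoinsAreUnions : Set ℓ
  JoinsAreUnions = ∀ X Y j → Join X Y j → ∀ u → IsSet u → u ∈ₘ j → u ∈ₘ X ⊎ u ∈ₘ Y

  ⊆-refl : ∀ X → X ⊆ X
  ⊆-refl X u _ u∈X = u∈X

  ⊆-trans : ∀ X Y Z → X ⊆ Y → Y ⊆ Z → X ⊆ Z
  ⊆-trans X Y Z X⊆Y Y⊆Z u su = Y⊆Z u su ∘ X⊆Y u su

  CExt⇒⊆-antisym : CExt 𝓜 → ∀ X Y → X ⊆ Y → Y ⊆ X → X ≡ Y
  CExt⇒⊆-antisym cext X Y X⊆Y Y⊆X = cext X Y λ u su → mk⇔ (X⊆Y u su) (Y⊆X u su)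

  ⊆-antisym⇒CExt : (∀ X Y → X ⊆ Y → Y ⊆ X → X ≡ Y) → CExt 𝓜
  ⊆-antisym⇒CExt antisym X Y same =
    antisym X Y (λ u su → to (same u su)) (λ u su → from (same u su))

  intersection⇒meet : ∀ X Y Z → IsIntersection X Y Z → Meet X Y Z
  intersection⇒meet X Y Z Z≈X∩Y =
    ((λ u su → proj₁ ∘ to (Z≈X∩Y u su)) , (λ u su → proj₂ ∘ to (Z≈X∩Y u su)))
    , λ W W⊆X W⊆Y u su u∈W → from (Z≈X∩Y u su) (W⊆X u su u∈W , W⊆Y u su u∈W)

  union⇒join : ∀ X Y Z → IsUnion X Y Z → Join X Y Z
  union⇒join X Y Z Z≈X∪Y =
    ((λ u su → from (Z≈X∪Y u su) ∘ inj₁) , (λ u su → from (Z≈X∪Y u su) ∘ inj₂))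
    , λ W X⊆W Y⊆W u su u∈Z → [ X⊆W u su , Y⊆W u su ] (to (Z≈X∪Y u su) u∈Z)

  CUnion⇒joinsAreUnions : CUnion 𝓜 → JoinsAreUnions
  CUnion⇒joinsAreUnions cunion X Y j (_ , least) u su u∈j =
    let (Z , Z≈X∪Y) = cunion X Y
        ((X⊆Z , Y⊆Z) , _) = union⇒join X Y Z Z≈X∪Y
    in to (Z≈X∪Y u su) (least Z X⊆Z Y⊆Z u su u∈j)

  top-notSet⇒UB : ExcludedMiddle ℓ → (∀ T → Top T → ¬ IsSet T) → UB 𝓜
  top-notSet⇒UB em top-notSet x sx = em⇒dne em λ x-universal →
    top-notSet x (λ Y u su _ → em⇒dne em λ u∉x → x-universal (u , su , u∉x)) sx

  module Singletons (emp : Emp 𝓜) (adj : Adj 𝓜) where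

    ∅ : Class
    ∅ = proj₁ emp

    ∅-isSet : IsSet ∅
    ∅-isSet = proj₁ (proj₂ emp)

    ∅-empty : ∀ u → IsSet u → ¬ u ∈ₘ ∅
    ∅-empty = proj₂ (proj₂ emp)

    ∅-isBottom : Bottom ∅
    ∅-isBottom X u su u∈∅ = ⊥-elim (∅-empty u su u∈∅)

    bottom-empty : ∀ Z → Bottom Z → ∀ u → IsSet u → ¬ u ∈ₘ Z
    bottom-empty Z Z-bottom u su = ∅-empty u su ∘ Z-bottom ∅ u su

    singleton : ∀ u → IsSet u → Class
    singleton u su = proj₁ (adj ∅ u ∅-isSet su)

    singleton-isSet : ∀ u su → IsSet (singleton u su)
    singleton-isSet u su = proj₁ (proj₂ (adj ∅ u ∅-isSet su))

    ∈-singleton⇒≡ : ∀ u su v → IsSet v → v ∈ₘ singleton u su → v ≡ u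
    ∈-singleton⇒≡ u su v sv =
      [ ⊥-elim ∘ ∅-empty v sv , id ] ∘ to (proj₂ (proj₂ (adj ∅ u ∅-isSet su)) v sv)

    u∈singleton : ∀ u su → u ∈ₘ singleton u su
    u∈singleton u su = from (proj₂ (proj₂ (adj ∅ u ∅-isSet su)) u su) (inj₂ refl)

    ∈⇒singleton⊆ : ∀ u su X → u ∈ₘ X → singleton u su ⊆ X
    ∈⇒singleton⊆ u su X u∈X v sv v∈ = subst (_∈ₘ X) (sym (∈-singleton⇒≡ u su v sv v∈)) u∈X

    singleton⊆⇒∈ : ∀ u su X → singleton u su ⊆ X → u ∈ₘ X
    singleton⊆⇒∈ u su X ⊆X = ⊆X u su (u∈singleton u su)

    singleton-injective : ∀ u su v sv → singleton u su ≡ singleton v sv → u ≡ v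
    singleton-injective u su v sv eq =
      ∈-singleton⇒≡ v sv u su (subst (u ∈ₘ_) eq (u∈singleton u su))

    meet⇒intersection : ∀ X Y m → Meet X Y m → IsIntersection X Y m
    meet⇒intersection X Y m ((m⊆X , m⊆Y) , greatest) u su =
      mk⇔ (λ u∈m → m⊆X u su u∈m , m⊆Y u su u∈m)
          (λ (u∈X , u∈Y) → singleton⊆⇒∈ u su m
             (greatest (singleton u su) (∈⇒singleton⊆ u su X u∈X) (∈⇒singleton⊆ u su Y u∈Y)))

    bottom-isSet : SubsetAx 𝓜 → ∀ Z → Bottom Z → IsSet Z
    bottom-isSet subset Z Z-bottom = subset ∅ Z ∅-isSet (Z-bottom ∅)

    top-notSet : UB 𝓜 → ∀ T → Top T → ¬ IsSet T
    top-notSet ub T T-top sT =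
      let (y , sy , y∉T) = ub T sT in y∉T (singleton⊆⇒∈ y sy T (T-top (singleton y sy)))

    join-isSet : SubsetAx 𝓜 → UnionAx 𝓜 → ∀ x y j → Join x y j → IsSet x → IsSet y → IsSet j
    join-isSet subset union x y j (_ , least) sx sy =
      let (z , sz , z≈x∪y) = union x y sx sy
          ((x⊆z , y⊆z) , _) = union⇒join x y z z≈x∪y
      in subset z j sz (least z x⊆z y⊆z)

    ∉⇒singleton-meet⊆∅ : ∀ u su Z n → Meet (singleton u su) Z n → ¬ u ∈ₘ Z → n ⊆ ∅
    ∉⇒singleton-meet⊆∅ u su Z n n-meet u∉Z v sv v∈n =
      let (v∈singleton , v∈Z) = to (meet⇒intersection _ Z n n-meet v sv) v∈n
      in ⊥-elim (u∉Z (subst (_∈ₘ Z) (∈-singleton⇒≡ u su v sv v∈singleton) v∈Z))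

    record DistinctMembers (n : ℕ) : Set ℓ where
      field
        element           : Fin n → Class
        element-isSet     : ∀ i → IsSet (element i)
        element-injective : ∀ i j → element i ≡ element j → i ≡ j
        bound             : Class
        bound-isSet       : IsSet bound
        element∈bound     : ∀ i → element i ∈ₘ bound

    addFresh : ∀ {n} (D : DistinctMembers n) → let open DistinctMembers D in
               ∃[ y ] (IsSet y × ¬ y ∈ₘ bound) → DistinctMembers (suc n)
    addFresh D (y , sy , y∉bound) = record
      { element           = y ∷ element
      ; element-isSet     = λ { zero → sy ; (suc i) → element-isSet i }
      ; element-injective = injective
      ; bound             = proj₁ bound+y
      ; bound-isSet       = proj₁ (proj₂ bound+y)
      ; element∈bound     = λ where
          zero    → from (proj₂ (proj₂ bound+y) y sy) (inj₂ refl)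
          (suc i) → from (proj₂ (proj₂ bound+y) (element i) (element-isSet i))
                         (inj₁ (element∈bound i))
      }
      where
      open DistinctMembers D
      bound+y : ∃[ z ] (IsSet z × ∀ u → IsSet u → (u ∈ₘ z ⇔ (u ∈ₘ bound ⊎ u ≡ y)))
      bound+y = adj bound y bound-isSet sy
      injective : ∀ i j → (y ∷ element) i ≡ (y ∷ element) j → i ≡ j
      injective zero    zero    _  = refl
      injective zero    (suc j) y≡ = ⊥-elim (y∉bound (subst (_∈ₘ bound) (sym y≡) (element∈bound j)))
      injective (suc i) zero    ≡y = ⊥-elim (y∉bound (subst (_∈ₘ bound) ≡y (element∈bound i)))
      injective (suc i) (suc j) eq = cong suc (element-injective i j eq)

    distinctMembers : UB 𝓜 → ∀ n → DistinctMembers n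
    distinctMembers ub zero = record
      { element = λ () ; element-isSet = λ () ; element-injective = λ ()
      ; bound = ∅ ; bound-isSet = ∅-isSet ; element∈bound = λ () }
    distinctMembers ub (suc n) = addFresh D (ub (bound D) (bound-isSet D))
      where
      D : DistinctMembers n
      D = distinctMembers ub n
      open DistinctMembers

    module _ (em : ExcludedMiddle ℓ) where

      nonBottom⇒hasMember : ∀ X → ¬ Bottom X → ∃[ u ] (IsSet u × u ∈ₘ X)
      nonBottom⇒hasMember X X-nonBottom = em⇒dne em λ noMember →
        X-nonBottom λ Y u su u∈X → ⊥-elim (noMember (u , su , u∈X))

      singleton-isAtom : CExt 𝓜 → ∀ u su → Atom (singleton u su)
      singleton-isAtom cext u su =
        (λ bottom → bottom-empty _ bottom u su (u∈singleton u su)) , below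
        where
        below : ∀ b → b ⊆ singleton u su → Bottom b ⊎ b ≡ singleton u su
        below b b⊆ with em {u ∈ₘ b}
        ... | yes u∈b = inj₂ (CExt⇒⊆-antisym cext _ _ b⊆ (∈⇒singleton⊆ u su b u∈b))
        ... | no u∉b = inj₁ λ Y v sv v∈b →
          ⊥-elim (u∉b (subst (_∈ₘ b) (∈-singleton⇒≡ u su v sv (b⊆ v sv v∈b)) v∈b))

      complement⇒compl : ∀ X C → IsComplement X C → Compl X C
      complement⇒compl X C C≈∁X = disjoint , covering
        where
        disjoint : ∀ m → Meet X C m → Bottom m
        disjoint m m-meet Y u su u∈m =
          let (u∈X , u∈C) = to (meet⇒intersection X C m m-meet u su) u∈m
          in ⊥-elim (to (C≈∁X u su) u∈C u∈X)
        covering : ∀ j → Join X C j → Top j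
        covering j ((X⊆j , C⊆j) , _) Y u su _ with em {u ∈ₘ X}
        ... | yes u∈X = X⊆j u su u∈X
        ... | no u∉X = C⊆j u su (from (C≈∁X u su) u∉X)

      -- If u ∉ X ∪ Y then {u} ∧ (X ∨ Y) = ({u} ∧ X) ∨ ({u} ∧ Y) ⊆ ∅, although it contains u.
      distributive⇒joinsAreUnions : (∀ X Y → ∃ (Meet X Y)) → (∀ X Y → ∃ (Join X Y)) →
                                     Distributive Class _⊆_ IsSet → JoinsAreUnions
      distributive⇒joinsAreUnions meet join distrib X Y j j-join u su u∈j = em⇒dne em λ u∉X∪Y →
        let ｛u｝ = singleton u su
            (m , ｛u｝∧j) = meet ｛u｝ j
            (a , ｛u｝∧X) = meet ｛u｝ X
            (b , ｛u｝∧Y) = meet ｛u｝ Y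
            (k , a∨b) = join a b
            m≡k = distrib ｛u｝ X Y j m a b k j-join ｛u｝∧j ｛u｝∧X ｛u｝∧Y a∨b
            u∈m = from (meet⇒intersection ｛u｝ j m ｛u｝∧j u su) (u∈singleton u su , u∈j)
            a⊆∅ = ∉⇒singleton-meet⊆∅ u su X a ｛u｝∧X (u∉X∪Y ∘ inj₁)
            b⊆∅ = ∉⇒singleton-meet⊆∅ u su Y b ｛u｝∧Y (u∉X∪Y ∘ inj₂)
        in ∅-empty u su (proj₂ a∨b ∅ a⊆∅ b⊆∅ u su (subst (u ∈ₘ_) m≡k u∈m))

      infinitelyManyAtoms : CExt 𝓜 → UB 𝓜 → InfinitelyManyAtoms Class _⊆_ IsSet
      infinitelyManyAtoms cext ub n =
          (λ i → singleton (element i) (element-isSet i))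
        , (λ i → singleton-isAtom cext (element i) (element-isSet i))
        , λ i j eq → element-injective i j (singleton-injective _ _ _ _ eq)
        where open DistinctMembers (distinctMembers ub n)

      finite-setBound : UnionAx 𝓜 → ∀ n (f : Fin n → Class) →
                        ∃[ s ] (IsSet s × ∀ i → IsSet (f i) → f i ⊆ s)
      finite-setBound union zero f = ∅ , ∅-isSet , λ ()
      finite-setBound union (suc n) f with finite-setBound union n (f ∘ suc) | em {IsSet (f zero)}
      ... | s , ss , tail⊆s | no head-notSet =
        s , ss , λ { zero head-set → ⊥-elim (head-notSet head-set) ; (suc i) → tail⊆s i }
      ... | s , ss , tail⊆s | yes head-set with union s (f zero) ss head-set
      ...   | w , sw , w≈s∪head = w , sw , λ where
                zero    _  u su → from (w≈s∪head u su) ∘ inj₂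
                (suc i) si u su → from (w≈s∪head u su) ∘ inj₁ ∘ tail⊆s i si u su

      finite⇒isSet : CExt 𝓜 → SubsetAx 𝓜 → UnionAx 𝓜 → FiniteInIdeal Class _⊆_ IsSet
      finite⇒isSet cext subset union n x (atom , atoms-listed) =
        let (s , ss , atoms⊆s) = finite-setBound union n atom in
        subset s x ss λ u su u∈x →
          let (i , ｛u｝≡atom) = atoms-listed (singleton u su) (singleton-isAtom cext u su)
                                              (∈⇒singleton⊆ u su x u∈x)
          in atoms⊆s i (subst IsSet ｛u｝≡atom (singleton-isSet u su)) u su
                       (subst (u ∈ₘ_) ｛u｝≡atom (u∈singleton u su))

    module Lattice (meet : ∀ X Y → ∃ (Meet X Y)) (join : ∀ X Y → ∃ (Join X Y))
                   (joinsAreUnions : JoinsAreUnions) where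

      join⇒union : ∀ X Y j → Join X Y j → IsUnion X Y j
      join⇒union X Y j j-join@((X⊆j , Y⊆j) , _) u su =
        mk⇔ (joinsAreUnions X Y j j-join u su) [ X⊆j u su , Y⊆j u su ]

      compl⇒complement : ∀ X c → Compl X c → IsComplement X c
      compl⇒complement X c (disjoint , covering) u su = mk⇔ u∈c⇒u∉X u∉X⇒u∈c
        where
        u∈c⇒u∉X : u ∈ₘ c → ¬ u ∈ₘ X
        u∈c⇒u∉X u∈c u∈X =
          let (m , m-meet) = meet X c
          in bottom-empty m (disjoint m m-meet) u su
               (from (meet⇒intersection X c m m-meet u su) (u∈X , u∈c))
        u∉X⇒u∈c : ¬ u ∈ₘ X → u ∈ₘ c
        u∉X⇒u∈c u∉X =
          let (j , j-join) = join X c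
              u∈j = singleton⊆⇒∈ u su j (covering j j-join (singleton u su))
          in [ ⊥-elim ∘ u∉X , id ] (joinsAreUnions X c j j-join u su u∈j)

      meet-compl⇒difference : ∀ X Y c m → Compl Y c → Meet X c m → IsDifference X Y m
      meet-compl⇒difference X Y c m c-compl m-meet u su =
        (⇔-id _ ×-⇔ compl⇒complement Y c c-compl u su) ⇔-∘ meet⇒intersection X c m m-meet u su

      distributive : CExt 𝓜 → Distributive Class _⊆_ IsSet
      distributive cext x y z j m a b k y∨z x∧j x∧y x∧z a∨b = cext m k λ u su →
        let open EquationalReasoning in
        begin
          u ∈ₘ m                                   ∼⟨ meet⇒intersection x j m x∧j u su ⟩
          (u ∈ₘ x × u ∈ₘ j)                        ∼⟨ ⇔-id _ ×-⇔ join⇒union y z j y∨z u su ⟩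
          (u ∈ₘ x × (u ∈ₘ y ⊎ u ∈ₘ z))             ↔⟨ ×-distribˡ-⊎ ⟩
          (u ∈ₘ x × u ∈ₘ y ⊎ u ∈ₘ x × u ∈ₘ z)     ∼⟨ ⇔-sym (meet⇒intersection x y a x∧y u su
                                                         ⊎-⇔ meet⇒intersection x z b x∧z u su) ⟩
          (u ∈ₘ a ⊎ u ∈ₘ b)                        ∼⟨ ⇔-sym (join⇒union a b k a∨b u su) ⟩
          u ∈ₘ k                                   ∎

      sep⇒splitting : SubsetAx 𝓜 → Sep 𝓜 → Splitting Class _⊆_ IsSet
      sep⇒splitting subset sep X X-notSet =
        let (Y , Y⊆X , Y-notSet , D , D≈X∖Y , D-notSet) = sep X X-notSet in
        Y , Y⊆X , Y-notSet , λ c m c-compl m-meet m-set →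
          D-notSet (subset m D m-set λ u su →
            from (meet-compl⇒difference X Y c m c-compl m-meet u su) ∘ to (D≈X∖Y u su))

      splitting⇒sep : Complemented Class _⊆_ IsSet → Splitting Class _⊆_ IsSet → Sep 𝓜
      splitting⇒sep complemented splitting X X-notSet =
        let (Y , Y⊆X , Y-notSet , rest-notSet) = splitting X X-notSet
            (c , c-compl) = complemented Y
            (m , m-meet) = meet X c
        in Y , Y⊆X , Y-notSet , m , meet-compl⇒difference X Y c m c-compl m-meet
         , rest-notSet c m c-compl m-meet

BAC⁺⇒IABA-Ideal : ExcludedMiddle ℓ → (𝓜 : ClStructure ℓ) → BAC⁺ 𝓜 →
                  IABA-Ideal (M 𝓜) (_⊆ᴹ_ 𝓜) (S 𝓜)
BAC⁺⇒IABA-Ideal em 𝓜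
  (((_ , subset , emp , adj) , cext , union , ub , cunion , cinter , ccomp) , sep) =
    ( (partialOrder , lattice , distributive cext , complemented , atomic
      , infinitelyManyAtoms em cext ub)
    , ( bottom-isSet subset , top-notSet ub , join-isSet subset union
      , λ x y y⊆x sx → subset x y sx y⊆x )
    , finite⇒isSet em cext subset union
    , sep⇒splitting subset sep )
  where
  open ClassAlgebra 𝓜
  open Singletons emp adj

  meet : ∀ X Y → ∃ (Meet X Y)
  meet X Y = let (Z , Z≈X∩Y) = cinter X Y in Z , intersection⇒meet X Y Z Z≈X∩Y

  join : ∀ X Y → ∃ (Join X Y)
  join X Y = let (Z , Z≈X∪Y) = cunion X Y in Z , union⇒join X Y Z Z≈X∪Y

  open Lattice meet join (CUnion⇒joinsAreUnions cunion)

  partialOrder : PartialOrder Class _⊆_ IsSet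
  partialOrder = ⊆-refl , CExt⇒⊆-antisym cext , ⊆-trans

  lattice : Lattice01 Class _⊆_ IsSet
  lattice = (∅ , ∅-isBottom)
          , (let (V , V≈∁∅) = ccomp ∅ in V , λ Y u su _ → from (V≈∁∅ u su) (∅-empty u su))
          , meet , join

  complemented : Complemented Class _⊆_ IsSet
  complemented X = let (C , C≈∁X) = ccomp X in C , complement⇒compl em X C C≈∁X

  atomic : Atomic Class _⊆_ IsSet
  atomic X X-nonBottom =
    let (u , su , u∈X) = nonBottom⇒hasMember em X X-nonBottom
    in singleton u su , singleton-isAtom em cext u su , ∈⇒singleton⊆ u su X u∈X

IABA-Ideal⇒BAC⁺ : ExcludedMiddle ℓ → (𝓜 : ClStructure ℓ) → CAS 𝓜 →
                  IABA-Ideal (M 𝓜) (_⊆ᴹ_ 𝓜) (S 𝓜) → BAC⁺ 𝓜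
IABA-Ideal⇒BAC⁺ em 𝓜 cas@(_ , _ , emp , adj)
  ( ((_ , antisym , _) , (_ , _ , meet , join) , distrib , complemented , _)
  , (_ , top-notInIdeal , join-inIdeal , _) , _ , splitting ) =
    ( cas , ⊆-antisym⇒CExt antisym , union , top-notSet⇒UB em top-notInIdeal
    , cunion , cinter , ccomp )
  , splitting⇒sep complemented splitting
  where
  open ClassAlgebra 𝓜
  open Singletons emp adj
  open Lattice meet join (distributive⇒joinsAreUnions em meet join distrib)

  union : UnionAx 𝓜
  union x y sx sy =
    let (j , j-join) = join x y in j , join-inIdeal x y j j-join sx sy , join⇒union x y j j-join

  cunion : CUnion 𝓜
  cunion X Y = let (j , j-join) = join X Y in j , join⇒union X Y j j-join

  cinter : CIntersection 𝓜
  cinter X Y = let (m , m-meet) = meet X Y in m , meet⇒intersection X Y m m-meet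

  ccomp : CComp 𝓜
  ccomp X = let (c , c-compl) = complemented X in c , compl⇒complement X c c-compl

mainTheorem19 : {ℓ : Level} → ExcludedMiddle ℓ → (𝓜 : ClStructure ℓ) → CAS 𝓜 →
    (BAC⁺ 𝓜 ⇔ IABA-Ideal (M 𝓜) (_⊆ᴹ_ 𝓜) (S 𝓜))
mainTheorem19 em 𝓜 cas = mk⇔ (BAC⁺⇒IABA-Ideal em 𝓜) (IABA-Ideal⇒BAC⁺ em 𝓜 cas)
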